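{- Assume the setting below. Let $X\subseteq E$ with $\mathrm{rk}(X)\le\ell$, and let $\psi:X\to\Gamma$ be $n/3$-consistent. Then $\psi$ is $2n/3$-consistent.
   Context: Setting: $\mathcal E$ is a family of $2$-connected $3$-regular expander graphs (infinite family with positive infimum of the expansion ratio $\min_{0<|W|\le|V|/2}|\partial(W)|/|W|$), and $c>0$ is a constant such that for every $G\in\mathcal E$ and every $X\subseteq E(G)$ there is $\hat X\supseteq X$ with $|\hat X|\le c|X|$ such that $E(G)\setminus\hat X$ is empty or the edge set of a $2$-connected subgraph of $G$. Fix $G=(V,E)\in\mathcal E$, $n=|V|$, $m=|E|$, $\ell=\lfloor (m-1)/(3c)\rfloor$. For $X\subseteq E$, $\mathrm{cl}(X)$ is the set of edges $x\in E$ such that no cycle of $G$ with edge set contained in $E\setminus X$ contains $x$ (so $X\subseteq\mathrm{cl}(X)$); this is a matroid closure operator. A set $I\subseteq E$ is independent if $x\notin\mathrm{cl}(I\setminus\{x\})$ for all $x\in I$, and $\mathrm{rk}(X)$ is the maximum size of an independent subset of $X$. Let $H$ be an orientation of $G$, $\Gamma$ a finite Abelian group, $\sigma:V\to\Gamma$; edges, their orientations, and variables $x_e$ are identified. For $W\subseteq V$, $\partial(W)$ is the set of edges between $W$ and $V\setminus W$, $\partial_\pm(W)$ the edges of $H$ with tail (+) resp. head (−) in $W$ and other end outside $W$, $\sigma(W)=\sum_{w\in W}\sigma(w)$, and $C(W)$ is the constraint $\sum_{e\in\partial_+(W)}x_e-\sum_{e\in\partial_-(W)}x_e=\sigma(W)$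 in $\Gamma$. A partial mapping $\psi$ from $E$ to $\Gamma$ is $k$-consistent if it satisfies $C(W)$ for every $W\subseteq V$ with $|W|\le k$ and $\partial(W)\subseteq\mathrm{dom}(\psi)$.
   Formalization: The constant c of the setting, which bounds $|\hat X|\le c|X|$ and defines ℓ, ranges over the positive rationals. -}

module Defs where

open import Level using (0ℓ)
open import Data.Nat using (ℕ; zero; suc; _+_; _*_; _∸_; _≤_; _<_)
open import Data.Nat.DivMod using (_mod_; _/_)
open import Data.Fin using (Fin; toℕ)
import Data.Fin as Fin
import Data.Unit as Unit
open import Data.Fin.Properties using () renaming (_≟_ to _≟ᶠ_)
open import Data.Fin.Subset using (Subset; _∈_; _∉_; _⊆_; ∣_∣; _-_; ⊤; ⊥; _∩_; ∁)
open import Data.Fin.Subset.Properties using (_∈?_)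
open import Data.Bool using (Bool; true; false; if_then_else_; _∨_; _∧_; _xor_; not)
open import Data.Vec using (tabulate)
open import Data.Product using (Σ; ∃; ∃-syntax; _×_; _,_)
open import Data.Sum using (_⊎_)
open import Relation.Nullary using (¬_)
open import Relation.Nullary.Decidable using (⌊_⌋)
open import Relation.Binary.PropositionalEquality using (_≡_; _≢_)
open import Function.Definitions using (Injective)
open import Algebra.Bundles using (AbelianGroup)

-- The order of the two
-- endpoints is merely a representation; orientations are separate.

record Graph : Set where
  field
    n m      : ℕ
    end₁     : Fin m → Fin n
    end₂     : Fin m → Fin n
    loopless : ∀ e → end₁ e ≢ end₂ e
    simple   : ∀ e f → (end₁ e ≡ end₁ f × end₂ e ≡ end₂ f)
                     ⊎ (end₁ e ≡ end₂ f × end₂ e ≡ end₁ f) → e ≡ f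

module _ (G : Graph) where
  open Graph G

  Joins : Fin m → Fin n → Fin n → Set
  Joins e u w = (end₁ e ≡ u × end₂ e ≡ w) ⊎ (end₂ e ≡ u × end₁ e ≡ w)

  incident : Fin n → Subset m
  incident v = tabulate (λ e → ⌊ end₁ e ≟ᶠ v ⌋ ∨ ⌊ end₂ e ≟ᶠ v ⌋)

  Cubic : Set
  Cubic = ∀ v → ∣ incident v ∣ ≡ 3

  ∂ : Subset n → Subset m
  ∂ W = tabulate (λ e → ⌊ end₁ e ∈? W ⌋ xor ⌊ end₂ e ∈? W ⌋)

  InV : Subset m → Fin n → Set
  InV F v = ∃[ e ] (e ∈ F × (end₁ e ≡ v ⊎ end₂ e ≡ v))

  data Reach (F : Subset m) : Fin n → Fin n → Set where
    here : ∀ {u} → Reach F u u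
    step : ∀ {u w v} e → e ∈ F → Joins e u w → Reach F w v → Reach F u v

  ConnectedSub : (Fin n → Set) → Subset m → Set
  ConnectedSub S F = ∀ u v → S u → S v → Reach F u v

  TwoConnectedSub : (Fin n → Set) → Subset m → Set
  TwoConnectedSub S F =
      (∃[ a ] ∃[ b ] ∃[ c ] (S a × S b × S c × a ≢ b × a ≢ c × b ≢ c))
    × ConnectedSub S F
    × (∀ w → S w → ConnectedSub (λ v → S v × v ≢ w) (F ∩ ∁ (incident w)))

  TwoConnected : Set
  TwoConnected = TwoConnectedSub (λ _ → Unit.⊤) ⊤

  TwoConnectedEdgeSet : Subset m → Set
  TwoConnectedEdgeSet F = TwoConnectedSub (InV F) F

  next : ∀ {k} → Fin (suc k) → Fin (suc k)
  next {k} i = suc (toℕ i) mod suc k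

  record Cycle : Set where
    field
      k     : ℕ
      long  : 3 ≤ suc k
      vs    : Fin (suc k) → Fin n
      vsInj : Injective _≡_ _≡_ vs
      es    : Fin (suc k) → Fin m
      join  : ∀ i → Joins (es i) (vs i) (vs (next i))

  InCl : Subset m → Fin m → Set
  InCl Y x = ¬ (Σ Cycle λ C → (∀ i → Cycle.es C i ∉ Y) × (∃[ i ] Cycle.es C i ≡ x))

  Independent : Subset m → Set
  Independent I = ∀ x → x ∈ I → ¬ InCl (I - x) x

  RankAtMost : Subset m → ℕ → Set
  RankAtMost X r = ∀ I → I ⊆ X → Independent I → ∣ I ∣ ≤ r

  -- an orientation of G: o e = true means e is directed end₁ → end₂
  Orientation : Set
  Orientation = Fin m → Bool

  tail head : Orientation → Fin m → Fin n
  tail o e = if o e then end₁ e else end₂ e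
  head o e = if o e then end₂ e else end₁ e

  -- ℓ = ⌊(m-1)/(3c)⌋ for c = (suc p)/(suc q)
  ell : (p q : ℕ) → ℕ
  ell p q = ((m ∸ 1) * suc q) / (3 * suc p)

  module _ (Γ : AbelianGroup 0ℓ 0ℓ) where
    open AbelianGroup Γ

    sumΓ : ∀ {k} → (Fin k → Carrier) → Carrier
    sumΓ {zero}  f = ε
    sumΓ {suc k} f = f Fin.zero ∙ sumΓ (λ i → f (Fin.suc i))

    σ[_] : (Fin n → Carrier) → Subset n → Carrier
    σ[ σ ] W = sumΓ (λ v → if ⌊ v ∈? W ⌋ then σ v else ε)

    Constraint : Orientation → (Fin n → Carrier) → (Fin m → Carrier) → Subset n → Set
    Constraint o σ ψ W = sumΓ contrib ≈ σ[ σ ] W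
      where
      contrib : Fin m → Carrier
      contrib e =
        if ⌊ tail o e ∈? W ⌋ ∧ not ⌊ head o e ∈? W ⌋ then ψ e
        else if ⌊ head o e ∈? W ⌋ ∧ not ⌊ tail o e ∈? W ⌋ then ψ e ⁻¹
        else ε

    Consistent : Orientation → (Fin n → Carrier) → (X : Subset m) → (Fin m → Carrier) → ℕ → Set
    Consistent o σ X ψ k = ∀ W → ∣ W ∣ ≤ k → ∂ W ⊆ X → Constraint o σ ψ W

FiniteAbelianGroup : AbelianGroup 0ℓ 0ℓ → Set
FiniteAbelianGroup Γ = ∃[ k ] Σ (Fin k → Carrier) λ f → ∀ g → ∃[ i ] f i ≈ g
  where open AbelianGroup Γ

-- The standing assumptions on the family ℰ, with c = (suc p)/(suc q).

record Setting (ℰ : Graph → Set) (p q : ℕ) : Set₁ where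
  field
    simpleCubic2conn : ∀ G → ℰ G → Cubic G × TwoConnected G
    infinite         : ∀ N → ∃[ G ] (ℰ G × N < Graph.n G)
    -- positive infimum of the expansion ratio: some a/b > 0 is a lower bound
    expander         : ∃[ a ] ∃[ b ] (0 < a × 0 < b ×
                         (∀ G → ℰ G → ∀ W → 0 < ∣ W ∣ → 2 * ∣ W ∣ ≤ Graph.n G →
                            a * ∣ W ∣ ≤ b * ∣ ∂ G W ∣))
    closeUp          : ∀ G → ℰ G → ∀ (X : Subset (Graph.m G)) →
                         ∃[ X̂ ] (X ⊆ X̂ × suc q * ∣ X̂ ∣ ≤ suc p * ∣ X ∣ ×
                           ((∀ e → e ∈ X̂) ⊎ TwoConnectedEdgeSet G (∁ X̂)))

module Submission where

open import Defs
open import Level using (0ℓ)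
open import Algebra.Bundles using (AbelianGroup)
open import Function using (_∘_)
open import Function.Definitions using (Injective)
open import Data.Empty using (⊥; ⊥-elim)
open import Data.Unit using (tt) renaming (⊤ to 𝟏)
open import Data.Bool using (Bool; true; false; _∨_; _xor_)
open import Data.Product using (Σ; ∃-syntax; _×_; _,_; proj₁)
open import Data.Sum using (_⊎_; inj₁; inj₂; [_,_])
open import Data.Nat using (ℕ; zero; suc; _+_; _*_; _∸_; _≤_; _<_; z≤n; s≤s)
open import Data.Nat.Properties
open import Data.Nat.DivMod using (_/_; _%_; m/n*n≤m; m≡m%n+[m/n]*n; m%n<n; m<n⇒m%n≡m; n%n≡0)
open import Algebra.Properties.Semiring.Sum +-*-semiring
  using (sum; ∑-comm; ∑-distrib-+; *-distribˡ-sum; sum-cong-≗)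
open import Data.Fin using (Fin; zero; suc; toℕ; inject₁; fromℕ)
open import Data.Fin.Properties
  using (toℕ-injective; toℕ-inject₁; toℕ-fromℕ; toℕ-fromℕ<; toℕ<n; any?) renaming (_≟_ to _≟ᶠ_)
open import Data.Fin.Relation.Unary.Top using (view; ‵fromℕ; ‵inj₁)
open import Data.Fin.Subset using (Subset; _∈_; _∉_; _⊆_; ∣_∣; ∁; _-_; ⁅_⁆; _∪_; _∩_; ⊤) renaming (⊥ to ∅)
open import Data.Fin.Subset.Properties using (_∈?_; p─q⊆p; ∉⊥; x∈⁅x⁆; x∈⁅y⁆⇒x≡y; x∈p∪q⁺; x∈p∪q⁻;
  x∈p∩q⁻; x∈∁p⇒x∉p; x∉p⇒x∈∁p; ∣⊤∣≡n; ∣∁p∣≡n∸∣p∣; ∣p∣≤n)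
open import Data.Vec using ([]; _∷_; lookup; there)
open import Data.Vec.Properties using (lookup∘tabulate; []=⇒lookup; lookup⇒[]=)
open import Data.List using (List; []; _∷_; allFin)
open import Data.List.Membership.Propositional using () renaming (_∈_ to _∈ˡ_)
open import Data.List.Membership.Propositional.Properties using (∈-allFin)
open import Data.List.Relation.Unary.Any using () renaming (here to hereˡ; there to thereˡ)
open import Relation.Nullary using (¬_)
open import Relation.Nullary.Decidable
  using (Dec; ⌊_⌋; yes; no; ¬¬-excluded-middle; isYes≗does; dec-true; dec-false)
open import Relation.Binary.PropositionalEquality hiding ([_])

-- Pick I ⊆ ∂(W) maximal such that G − I stays connected.
-- Then I is independent (each x ∈ I closes a path of G − I to a cycle), so
-- |I| ≤ ℓ, and the setting provides Î ⊇ I with |Î| ≤ c|I| ≤ (m − 1)/3 whose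
-- complement is empty or 2-connected.  Every edge of a 2-connected graph
-- has a detour, so by maximality of I no edge outside Î crosses ∂(W): the
-- complement of Î lies on one side and Î contains all stars of the other
-- side.  Double counting in the cubic graph makes that side smaller than
-- n/3, whereas both sides have at least n/3 vertices.

𝟙 : Bool → ℕ
𝟙 true  = 1
𝟙 false = 0

sum-mono : ∀ {k} {f g : Fin k → ℕ} → (∀ i → f i ≤ g i) → sum f ≤ sum g
sum-mono {zero}  f≤g = z≤n
sum-mono {suc k} f≤g = +-mono-≤ (f≤g zero) (sum-mono (f≤g ∘ suc))

sum-const : ∀ {k} c → sum {k} (λ _ → c) ≡ k * c
sum-const {zero}  c = refl
sum-const {suc k} c = cong (c +_) (sum-const {k} c)

sum-delta : ∀ {k} (a : Fin k) → sum (λ i → 𝟙 ⌊ a ≟ᶠ i ⌋) ≡ 1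
sum-delta {suc k} zero    = cong suc (trans (sum-const {k} 0) (*-zeroʳ k))
sum-delta {suc k} (suc a) = trans (sum-cong-≗ δ-suc) (sum-delta a)
  where
  δ-suc : ∀ i → 𝟙 ⌊ suc a ≟ᶠ suc i ⌋ ≡ 𝟙 ⌊ a ≟ᶠ i ⌋
  δ-suc i with a ≟ᶠ i
  ... | yes refl = refl
  ... | no  _    = refl

∣∣-sum : ∀ {k} (p : Subset k) → ∣ p ∣ ≡ sum (λ i → 𝟙 (lookup p i))
∣∣-sum []          = refl
∣∣-sum (true ∷ p)  = cong suc (∣∣-sum p)
∣∣-sum (false ∷ p) = ∣∣-sum p

div3-below : ∀ n w → n / 3 < w → n < 3 * w
div3-below n w n/3<w = begin-strict
  n                    ≡⟨ m≡m%n+[m/n]*n n 3 ⟩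
  n % 3 + n / 3 * 3    <⟨ +-monoˡ-< (n / 3 * 3) (m%n<n n 3) ⟩
  3 + n / 3 * 3        ≡⟨ trans (cong (3 +_) (*-comm (n / 3) 3)) (sym (*-suc 3 (n / 3))) ⟩
  3 * suc (n / 3)      ≤⟨ *-monoʳ-≤ 3 n/3<w ⟩
  3 * w ∎
  where open ≤-Reasoning

div3-above : ∀ n w → w ≤ (2 * n) / 3 → 3 * w ≤ 2 * n
div3-above n w w≤2n/3 = begin
  3 * w              ≤⟨ *-monoʳ-≤ 3 w≤2n/3 ⟩
  3 * ((2 * n) / 3)  ≡⟨ *-comm 3 ((2 * n) / 3) ⟩
  (2 * n) / 3 * 3    ≤⟨ m/n*n≤m (2 * n) 3 ⟩
  2 * n ∎
  where open ≤-Reasoning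

-- With c = (1+p)/(1+q) and ℓ = ⌊(m−1)/(3c)⌋: if |I| ≤ ℓ and |Î| ≤ c|I|, then 3|Î| ≤ m − 1.
closure-bound : ∀ m p q {i h} → i ≤ ((m ∸ 1) * suc q) / (3 * suc p) → suc q * h ≤ suc p * i →
                3 * h ≤ m ∸ 1
closure-bound m p q {i} {h} i≤ℓ h≤ci = *-cancelˡ-≤ (suc q) (begin
  suc q * (3 * h)   ≡⟨ *-comm-middle ⟩
  3 * (suc q * h)   ≤⟨ *-monoʳ-≤ 3 h≤ci ⟩
  3 * (suc p * i)   ≤⟨ *-monoʳ-≤ 3 (*-monoʳ-≤ (suc p) i≤ℓ) ⟩
  3 * (suc p * ℓ)   ≡⟨ trans (sym (*-assoc 3 (suc p) ℓ)) (*-comm (3 * suc p) ℓ) ⟩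
  ℓ * (3 * suc p)   ≤⟨ m/n*n≤m ((m ∸ 1) * suc q) (3 * suc p) ⟩
  (m ∸ 1) * suc q   ≡⟨ *-comm (m ∸ 1) (suc q) ⟩
  suc q * (m ∸ 1) ∎)
  where
  open ≤-Reasoning
  ℓ = ((m ∸ 1) * suc q) / (3 * suc p)
  *-comm-middle : suc q * (3 * h) ≡ 3 * (suc q * h)
  *-comm-middle = trans (sym (*-assoc (suc q) 3 h))
                        (trans (cong (_* h) (*-comm (suc q) 3)) (*-assoc 3 (suc q) h))

third-bound : ∀ {n m t s} → 0 < n → 2 * m ≤ 3 * n → 3 * t ≤ m ∸ 1 → 3 * s ≤ 2 * t → 3 * s < n
third-bound {n} {m} {t} {s} 0<n m-bound t-bound s-bound = *-cancelˡ-< 3 (3 * s) n (begin-strict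
  3 * (3 * s)  ≤⟨ *-monoʳ-≤ 3 s-bound ⟩
  3 * (2 * t)  ≡⟨ trans (sym (*-assoc 3 2 t)) (*-assoc 2 3 t) ⟩
  2 * (3 * t)  ≤⟨ *-monoʳ-≤ 2 t-bound ⟩
  2 * (m ∸ 1)  <⟨ below m m-bound ⟩
  3 * n ∎)
  where
  open ≤-Reasoning
  below : ∀ m → 2 * m ≤ 3 * n → 2 * (m ∸ 1) < 3 * n
  below zero     _        = *-monoʳ-< 3 0<n
  below (suc m′) m-bound′ = <-≤-trans (*-monoʳ-< 2 (n<1+n m′)) m-bound′

complement-bound : ∀ {n s w} → s + w ≡ n → 3 * w ≤ 2 * n → n ≤ 3 * s
complement-bound {n} {s} {w} s+w≡n w-bound = +-cancelʳ-≤ (3 * w) n (3 * s) (begin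
  n + 3 * w      ≤⟨ +-monoʳ-≤ n w-bound ⟩
  3 * n          ≡⟨ cong (3 *_) (sym s+w≡n) ⟩
  3 * (s + w)    ≡⟨ *-distribˡ-+ 3 s w ⟩
  3 * s + 3 * w ∎)
  where open ≤-Reasoning

positive : ∀ {n w} → n < 3 * w → 3 * w ≤ 2 * n → 0 < n
positive {zero}  large small = ⊥-elim (<-irrefl refl (<-≤-trans large small))
positive {suc n} _     _     = s≤s z≤n

module DoubleCounting (G : Graph) where
  open Graph G

  incidence : Fin m → Fin n → ℕ
  incidence e v = 𝟙 (lookup (incident G v) e)

  incidence-ends : ∀ e v → incidence e v ≡ 𝟙 ⌊ end₁ e ≟ᶠ v ⌋ + 𝟙 ⌊ end₂ e ≟ᶠ v ⌋
  incidence-ends e v rewrite lookup∘tabulate (λ f → ⌊ end₁ f ≟ᶠ v ⌋ ∨ ⌊ end₂ f ≟ᶠ v ⌋) e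
    with end₁ e ≟ᶠ v | end₂ e ≟ᶠ v
  ... | yes e₁≡v | yes e₂≡v = ⊥-elim (loopless e (trans e₁≡v (sym e₂≡v)))
  ... | yes _    | no  _    = refl
  ... | no  _    | yes _    = refl
  ... | no  _    | no  _    = refl

  -- Every edge has exactly two ends (this is where looplessness is used).
  two-ends : ∀ e → sum (incidence e) ≡ 2
  two-ends e = begin
    sum (incidence e)
      ≡⟨ sum-cong-≗ (incidence-ends e) ⟩
    sum (λ v → 𝟙 ⌊ end₁ e ≟ᶠ v ⌋ + 𝟙 ⌊ end₂ e ≟ᶠ v ⌋)
      ≡⟨ ∑-distrib-+ (λ v → 𝟙 ⌊ end₁ e ≟ᶠ v ⌋) (λ v → 𝟙 ⌊ end₂ e ≟ᶠ v ⌋) ⟩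
    sum (λ v → 𝟙 ⌊ end₁ e ≟ᶠ v ⌋) + sum (λ v → 𝟙 ⌊ end₂ e ≟ᶠ v ⌋)
      ≡⟨ cong₂ _+_ (sum-delta (end₁ e)) (sum-delta (end₂ e)) ⟩
    2 ∎
    where open ≡-Reasoning

  degreeIn : Subset m → Fin n → ℕ
  degreeIn T v = sum (λ e → 𝟙 (lookup T e) * incidence e v)

  handshake : ∀ T → sum (degreeIn T) ≡ 2 * ∣ T ∣
  handshake T = begin
    sum (λ v → sum (λ e → 𝟙 (lookup T e) * incidence e v))
      ≡⟨ ∑-comm (λ v e → 𝟙 (lookup T e) * incidence e v) ⟩
    sum (λ e → sum (λ v → 𝟙 (lookup T e) * incidence e v))
      ≡⟨ sum-cong-≗ (λ e → sym (*-distribˡ-sum (𝟙 (lookup T e)) (incidence e))) ⟩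
    sum (λ e → 𝟙 (lookup T e) * sum (incidence e))
      ≡⟨ sum-cong-≗ (λ e → trans (cong (𝟙 (lookup T e) *_) (two-ends e)) (*-comm (𝟙 (lookup T e)) 2)) ⟩
    sum (λ e → 2 * 𝟙 (lookup T e))
      ≡⟨ *-distribˡ-sum 2 (λ e → 𝟙 (lookup T e)) ⟨
    2 * sum (λ e → 𝟙 (lookup T e))
      ≡⟨ cong (2 *_) (∣∣-sum T) ⟨
    2 * ∣ T ∣ ∎
    where open ≡-Reasoning

  cubic-degree : Cubic G → ∀ v → sum (λ e → incidence e v) ≡ 3
  cubic-degree cubic v = trans (sym (∣∣-sum (incident G v))) (cubic v)

  Covers : Subset m → Subset n → Set
  Covers T S = ∀ {v} → v ∈ S → incident G v ⊆ T

  edges-bound : Cubic G → ∀ T → 2 * ∣ T ∣ ≤ 3 * n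
  edges-bound cubic T = begin
    2 * ∣ T ∣                               ≡⟨ handshake T ⟨
    sum (degreeIn T)
      ≤⟨ sum-mono (λ v → sum-mono (λ e → below (lookup T e) (incidence e v))) ⟩
    sum (λ v → sum (λ e → incidence e v))   ≡⟨ sum-cong-≗ (cubic-degree cubic) ⟩
    sum {n} (λ _ → 3)                       ≡⟨ trans (sum-const {n} 3) (*-comm n 3) ⟩
    3 * n ∎
    where
    open ≤-Reasoning
    below : ∀ b x → 𝟙 b * x ≤ x
    below true  x = ≤-reflexive (+-identityʳ x)
    below false _ = z≤n

  covered-bound : Cubic G → ∀ S T → Covers T S → 3 * ∣ S ∣ ≤ 2 * ∣ T ∣
  covered-bound cubic S T covers = begin
    3 * ∣ S ∣                         ≡⟨ cong (3 *_) (∣∣-sum S) ⟩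
    3 * sum (λ v → 𝟙 (lookup S v))    ≡⟨ *-distribˡ-sum 3 (λ v → 𝟙 (lookup S v)) ⟩
    sum (λ v → 3 * 𝟙 (lookup S v))    ≤⟨ sum-mono at ⟩
    sum (degreeIn T)                  ≡⟨ handshake T ⟩
    2 * ∣ T ∣ ∎
    where
    open ≤-Reasoning
    at : ∀ v → 3 * 𝟙 (lookup S v) ≤ degreeIn T v
    at v with lookup S v in v∈S
    ... | false = z≤n
    ... | true  = ≤-reflexive (sym (trans (sum-cong-≗ counted) (cubic-degree cubic v)))
      where
      counted : ∀ e → 𝟙 (lookup T e) * incidence e v ≡ incidence e v
      counted e with lookup (incident G v) e in e∈star
      ... | false = *-zeroʳ (𝟙 (lookup T e))
      ... | true  rewrite []=⇒lookup (covers (lookup⇒[]= v S v∈S) (lookup⇒[]= e _ e∈star)) = refl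

  covered-small : Cubic G → 0 < n → ∀ {S T} → 3 * ∣ T ∣ ≤ m ∸ 1 → Covers T S → 3 * ∣ S ∣ < n
  covered-small cubic 0<n {S} {T} T-small covers =
    third-bound {m = m} {t = ∣ T ∣} {s = ∣ S ∣} 0<n
      (subst (λ k → 2 * k ≤ 3 * n) (∣⊤∣≡n m) (edges-bound cubic ⊤)) T-small (covered-bound cubic S T covers)

module Walks (G : Graph) where
  open Graph G

  joins-sym : ∀ {e u w} → Joins G e u w → Joins G e w u
  joins-sym (inj₁ (p , q)) = inj₂ (q , p)
  joins-sym (inj₂ (p , q)) = inj₁ (q , p)

  -- Walks from u to v all of whose edges satisfy P (Defs' Reach, for an
  -- edge predicate instead of an edge subset).
  data Walk (P : Fin m → Set) : Fin n → Fin n → Set where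
    nil  : ∀ {u} → Walk P u u
    cons : ∀ {u w v} e → P e → Joins G e u w → Walk P w v → Walk P u v

  Connected : (Fin m → Set) → Set
  Connected P = ∀ u v → Walk P u v

  module _ {P : Fin m → Set} where

    _++_ : ∀ {u w v} → Walk P u w → Walk P w v → Walk P u v
    nil           ++ s = s
    cons e p j r  ++ s = cons e p j (r ++ s)

    reverse : ∀ {u v} → Walk P u v → Walk P v u
    reverse nil            = nil
    reverse (cons e p j r) = reverse r ++ cons e p (joins-sym j) nil

  weaken : ∀ {P Q : Fin m → Set} → (∀ e → P e → Q e) → ∀ {u v} → Walk P u v → Walk Q u v
  weaken P⇒Q nil            = nil
  weaken P⇒Q (cons e p j r) = cons e (P⇒Q e p) j (weaken P⇒Q r)

  fromReach : ∀ {F} {P : Fin m → Set} → (∀ e → e ∈ F → P e) → ∀ {u v} → Reach G F u v → Walk P u v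
  fromReach F⇒P here           = nil
  fromReach F⇒P (step e p j r) = cons e (F⇒P e p) j (fromReach F⇒P r)

  module _ {P : Fin m → Set} where

    length : ∀ {u v} → Walk P u v → ℕ
    length nil            = 0
    length (cons e p j r) = suc (length r)

    vertex : ∀ {u v} (r : Walk P u v) → Fin (suc (length r)) → Fin n
    vertex {u} r              zero    = u
    vertex     (cons e p j r) (suc i) = vertex r i

    closingEdge : ∀ {u v} (r : Walk P u v) → Fin m → Fin (suc (length r)) → Fin m
    closingEdge nil            x zero    = x
    closingEdge (cons e p j r) x zero    = e
    closingEdge (cons e p j r) x (suc i) = closingEdge r x i

    IsPath : ∀ {u v} → Walk P u v → Set
    IsPath nil                  = 𝟏
    IsPath (cons {u} e p j r)   = (∀ i → vertex r i ≢ u) × IsPath r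

    Path : Fin n → Fin n → Set
    Path u v = Σ (Walk P u v) IsPath

    vertex-injective : ∀ {u v} (r : Walk P u v) → IsPath r → Injective _≡_ _≡_ (vertex r)
    vertex-injective r              path          {zero}  {zero}  eq = refl
    vertex-injective (cons e p j r) (fresh , _)    {zero}  {suc i} eq = ⊥-elim (fresh i (sym eq))
    vertex-injective (cons e p j r) (fresh , _)    {suc i} {zero}  eq = ⊥-elim (fresh i eq)
    vertex-injective (cons e p j r) (_ , path)     {suc i} {suc k} eq = cong suc (vertex-injective r path eq)

    suffix : ∀ {u w v} (r : Walk P w v) i → vertex r i ≡ u → IsPath r → Path u v
    suffix r              zero    refl path       = r , path
    suffix (cons e p j r) (suc i) eq   (_ , path) = suffix r i eq path

    toPath : ∀ {u v} → Walk P u v → Path u v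
    toPath nil = nil , tt
    toPath (cons {u} e p j r) with toPath r
    ... | r′ , path with any? (λ i → vertex r′ i ≟ᶠ u)
    ...   | yes (i , revisit) = suffix r′ i revisit path
    ...   | no  fresh         = cons e p j r′ , (λ i eq → fresh (i , eq)) , path

    closingEdge-joins : ∀ {u v} (r : Walk P u v) x (i : Fin (length r)) →
      Joins G (closingEdge r x (inject₁ i)) (vertex r (inject₁ i)) (vertex r (suc i))
    closingEdge-joins (cons e p j nil)              x zero    = j
    closingEdge-joins (cons e p j (cons _ _ _ _))   x zero    = j
    closingEdge-joins (cons e p j r)                x (suc i) = closingEdge-joins r x i

    last-vertex : ∀ {u v} (r : Walk P u v) → vertex r (fromℕ (length r)) ≡ v
    last-vertex nil            = refl
    last-vertex (cons e p j r) = last-vertex r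

    last-edge : ∀ {u v} (r : Walk P u v) x → closingEdge r x (fromℕ (length r)) ≡ x
    last-edge nil            x = refl
    last-edge (cons e p j r) x = last-edge r x

    closingEdge-property : ∀ {u v} (r : Walk P u v) x i → P (closingEdge r x i) ⊎ closingEdge r x i ≡ x
    closingEdge-property nil            x zero    = inj₂ refl
    closingEdge-property (cons e p j r) x zero    = inj₁ p
    closingEdge-property (cons e p j r) x (suc i) = closingEdge-property r x i

  next-inject₁ : ∀ {k} (i : Fin k) → next G (inject₁ i) ≡ suc i
  next-inject₁ {k} i = toℕ-injective (begin
    toℕ (next G (inject₁ i))        ≡⟨ toℕ-fromℕ< _ ⟩
    suc (toℕ (inject₁ i)) % suc k   ≡⟨ cong (λ t → suc t % suc k) (toℕ-inject₁ i) ⟩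
    suc (toℕ i) % suc k             ≡⟨ m<n⇒m%n≡m (s≤s (toℕ<n i)) ⟩
    suc (toℕ i) ∎)
    where open ≡-Reasoning

  next-fromℕ : ∀ k → next G (fromℕ k) ≡ zero
  next-fromℕ k = toℕ-injective (begin
    toℕ (next G (fromℕ k))       ≡⟨ toℕ-fromℕ< _ ⟩
    suc (toℕ (fromℕ k)) % suc k  ≡⟨ cong (λ t → suc t % suc k) (toℕ-fromℕ k) ⟩
    suc k % suc k                ≡⟨ n%n≡0 (suc k) ⟩
    0 ∎)
    where open ≡-Reasoning

  closeCycle : ∀ {P a b} ((r , path) : Path {P} a b) → 2 ≤ length r → ∀ x → Joins G x b a → Cycle G
  closeCycle (r , path) long x x-joins = record
    { k = length r ; long = s≤s long ; vs = vertex r ; vsInj = vertex-injective r path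
    ; es = closingEdge r x ; join = joins }
    where
    joins : ∀ i → Joins G (closingEdge r x i) (vertex r i) (vertex r (next G i))
    joins i with view i
    ... | ‵inj₁ {i = j} _ rewrite next-inject₁ j = closingEdge-joins r x j
    ... | ‵fromℕ rewrite next-fromℕ (length r) | last-edge r x | last-vertex r = x-joins

  parallel : ∀ f x → Joins G f (end₁ x) (end₂ x) → f ≡ x
  parallel f x (inj₁ (p , q)) = simple f x (inj₁ (p , q))
  parallel f x (inj₂ (p , q)) = simple f x (inj₂ (q , p))

  two-edges : ∀ {P u v} (r : Walk P u v) → u ≢ v → (∀ f → P f → ¬ Joins G f u v) → 2 ≤ length r
  two-edges nil                        u≢v _      = ⊥-elim (u≢v refl)
  two-edges (cons f p j nil)           _   no-edge = ⊥-elim (no-edge f p j)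
  two-edges (cons _ _ _ (cons _ _ _ _)) _   _      = s≤s (s≤s z≤n)

  x∉p-x : ∀ {k} (p : Subset k) x → x ∉ p - x
  x∉p-x (s ∷ p) zero    ()
  x∉p-x (s ∷ p) (suc x) (there x∈p-x) = x∉p-x p x x∈p-x

  -- If G − I is connected then I is independent: for x ∈ I, a path in G − I
  -- between the ends of x closes with x to a cycle avoiding I − x.
  connected⇒independent : ∀ I → Connected (_∉ I) → Independent G I
  connected⇒independent I connected x x∈I x∈cl =
    x∈cl (cycle , avoids , fromℕ (length r) , last-edge r x)
    where
    ρ : Path (end₁ x) (end₂ x)
    ρ = toPath (connected (end₁ x) (end₂ x))
    r = proj₁ ρ
    no-edge : ∀ f → f ∉ I → ¬ Joins G f (end₁ x) (end₂ x)
    no-edge f f∉I j = f∉I (subst (_∈ I) (sym (parallel f x j)) x∈I)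
    cycle : Cycle G
    cycle = closeCycle ρ (two-edges r (loopless x) no-edge) x (inj₂ (refl , refl))
    avoids : ∀ i → closingEdge r x i ∉ I - x
    avoids i with closingEdge-property r x i
    ... | inj₁ f∉I = f∉I ∘ p─q⊆p I ⁅ x ⁆
    ... | inj₂ is-x = subst (_∉ I - x) (sym is-x) (x∉p-x I x)

  Avoiding : Subset m → Fin m → Fin m → Set
  Avoiding I e f = f ∉ I × f ≢ e

  MaximalAmong : List (Fin m) → Subset m → Subset m → Set
  MaximalAmong L D I = I ⊆ D × Connected (_∉ I)
                     × (∀ e → e ∈ˡ L → e ∈ D → e ∉ I → ¬ Connected (Avoiding I e))

  -- Greedy choice, one candidate edge at a time.  Whether a deletion keeps G
  -- connected is not decided here, so the result is stated under ¬¬.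
  greedy : Connected (λ _ → 𝟏) → ∀ D L → ¬ ¬ Σ (Subset m) (MaximalAmong L D)
  greedy connected D [] no-max =
    no-max (∅ , (⊥-elim ∘ ∉⊥) , (λ u v → weaken (λ _ _ → ∉⊥) (connected u v)) , λ _ ())
  greedy connected D (e ∷ L) no-max = greedy connected D L extend
    where
    keep : ∀ {I} → MaximalAmong L D I → (e ∈ D → e ∉ I → ¬ Connected (Avoiding I e)) → ⊥
    keep {I} (I⊆D , connected-I , maximal) stuck = no-max (_ , I⊆D , connected-I , maximal′)
      where
      maximal′ : ∀ e′ → e′ ∈ˡ e ∷ L → e′ ∈ D → e′ ∉ I → ¬ Connected (Avoiding I e′)
      maximal′ e′ (hereˡ refl)  = stuck
      maximal′ e′ (thereˡ e′∈L) = maximal e′ e′∈L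

    add : ∀ {I} → MaximalAmong L D I → e ∈ D → Connected (Avoiding I e) →
          MaximalAmong (e ∷ L) D (⁅ e ⁆ ∪ I)
    add {I} (I⊆D , _ , maximal) e∈D connected-e = I′⊆D , connected-I′ , maximal′
      where
      ∉I : ∀ {f} → f ∉ ⁅ e ⁆ ∪ I → f ∉ I
      ∉I f∉I′ f∈I = f∉I′ (x∈p∪q⁺ (inj₂ f∈I))
      I′⊆D : ⁅ e ⁆ ∪ I ⊆ D
      I′⊆D f∈I′ = [ (λ f∈e → subst (_∈ D) (sym (x∈⁅y⁆⇒x≡y e f∈e)) e∈D) , I⊆D ]
                    (x∈p∪q⁻ ⁅ e ⁆ I f∈I′)
      connected-I′ : Connected (_∉ ⁅ e ⁆ ∪ I)
      connected-I′ u v = weaken (λ f (f∉I , f≢e) f∈I′ → [ f≢e ∘ x∈⁅y⁆⇒x≡y e , f∉I ] (x∈p∪q⁻ ⁅ e ⁆ I f∈I′))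
                                (connected-e u v)
      maximal′ : ∀ e′ → e′ ∈ˡ e ∷ L → e′ ∈ D → e′ ∉ ⁅ e ⁆ ∪ I → ¬ Connected (Avoiding (⁅ e ⁆ ∪ I) e′)
      maximal′ e′ (hereˡ refl)  _    e∉I′ _            = e∉I′ (x∈p∪q⁺ (inj₁ (x∈⁅x⁆ e)))
      maximal′ e′ (thereˡ e′∈L) e′∈D e′∉I′ connected-e′ =
        maximal e′ e′∈L e′∈D (∉I e′∉I′)
          (λ u v → weaken (λ f (f∉I′ , f≢e′) → ∉I f∉I′ , f≢e′) (connected-e′ u v))

    extend : ¬ Σ (Subset m) (MaximalAmong L D)
    extend (I , max) with e ∈? D | e ∈? I
    ... | no e∉D  | _       = keep max (λ e∈D → ⊥-elim (e∉D e∈D))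
    ... | yes _   | yes e∈I = keep max (λ _ e∉I → ⊥-elim (e∉I e∈I))
    ... | yes e∈D | no _    = ¬¬-excluded-middle λ where
      (no  disconnects) → keep max (λ _ _ → disconnects)
      (yes connected-e) → no-max (_ , add max e∈D connected-e)

module Cuts (G : Graph) where
  open Graph G
  open DoubleCounting G using (Covers)
  open Walks G

  ends-incident : ∀ e z → end₁ e ≡ z ⊎ end₂ e ≡ z → e ∈ incident G z
  ends-incident e z at = lookup⇒[]= e (incident G z) (trans (lookup∘tabulate _ e) (is-end at))
    where
    is-end : end₁ e ≡ z ⊎ end₂ e ≡ z → (⌊ end₁ e ≟ᶠ z ⌋ ∨ ⌊ end₂ e ≟ᶠ z ⌋) ≡ true
    is-end at with end₁ e ≟ᶠ z | end₂ e ≟ᶠ z | at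
    ... | yes _ | _     | _      = refl
    ... | no  _ | yes _ | _      = refl
    ... | no  ¬₁ | no ¬₂ | inj₁ p = ⊥-elim (¬₁ p)
    ... | no  ¬₁ | no ¬₂ | inj₂ q = ⊥-elim (¬₂ q)

  incident-ends : ∀ e z → e ∈ incident G z → end₁ e ≡ z ⊎ end₂ e ≡ z
  incident-ends e z e∈star with end₁ e ≟ᶠ z | end₂ e ≟ᶠ z
                              | trans (sym (lookup∘tabulate _ e)) ([]=⇒lookup e∈star)
  ... | yes p | _     | _ = inj₁ p
  ... | no  _ | yes q | _ = inj₂ q
  ... | no  _ | no  _ | ()

  third-vertex : ∀ {S : Fin n → Set} u v →
    (∃[ a ] ∃[ b ] ∃[ c ] (S a × S b × S c × a ≢ b × a ≢ c × b ≢ c)) →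
    ∃[ w ] (S w × w ≢ u × w ≢ v)
  third-vertex u v (a , b , c , Sa , Sb , Sc , a≢b , a≢c , b≢c) with fresh a | fresh b | fresh c
    where
    fresh : ∀ z → (z ≡ u ⊎ z ≡ v) ⊎ (z ≢ u × z ≢ v)
    fresh z with z ≟ᶠ u | z ≟ᶠ v
    ... | yes z≡u | _       = inj₁ (inj₁ z≡u)
    ... | no  _   | yes z≡v = inj₁ (inj₂ z≡v)
    ... | no  z≢u | no z≢v  = inj₂ (z≢u , z≢v)
  ... | inj₂ new | _        | _        = a , Sa , new
  ... | inj₁ _   | inj₂ new | _        = b , Sb , new
  ... | inj₁ _   | inj₁ _   | inj₂ new = c , Sc , new
  ... | inj₁ ha  | inj₁ hb  | inj₁ hc  = ⊥-elim (pigeonhole ha hb hc)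
    where
    pigeonhole : (a ≡ u ⊎ a ≡ v) → (b ≡ u ⊎ b ≡ v) → (c ≡ u ⊎ c ≡ v) → ⊥
    pigeonhole (inj₁ p) (inj₁ q) _        = a≢b (trans p (sym q))
    pigeonhole (inj₂ p) (inj₂ q) _        = a≢b (trans p (sym q))
    pigeonhole (inj₁ p) _        (inj₁ r) = a≢c (trans p (sym r))
    pigeonhole (inj₂ p) _        (inj₂ r) = a≢c (trans p (sym r))
    pigeonhole _        (inj₁ q) (inj₁ r) = b≢c (trans q (sym r))
    pigeonhole _        (inj₂ q) (inj₂ r) = b≢c (trans q (sym r))

  -- Every edge e of a 2-connected subgraph F has a detour: its ends are
  -- joined in F − e, namely through a third vertex w, first avoiding the
  -- second end of e and then avoiding the first.
  detour : ∀ F → TwoConnectedEdgeSet G F → ∀ e → e ∈ F → Walk (λ f → f ∈ F × f ≢ e) (end₁ e) (end₂ e)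
  detour F (three , _ , connected-without) e e∈F with third-vertex (end₁ e) (end₂ e) three
  ... | w , Fw , w≢u , w≢v =
    avoiding (end₂ e) (inj₂ refl)
      (connected-without (end₂ e) Fv (end₁ e) w (Fu , loopless e) (Fw , w≢v))
    ++ avoiding (end₁ e) (inj₁ refl)
      (connected-without (end₁ e) Fu w (end₂ e) (Fw , w≢u) (Fv , loopless e ∘ sym))
    where
    Fu : InV G F (end₁ e)
    Fu = e , e∈F , inj₁ refl
    Fv : InV G F (end₂ e)
    Fv = e , e∈F , inj₂ refl
    avoiding : ∀ z → end₁ e ≡ z ⊎ end₂ e ≡ z → ∀ {x y} →
               Reach G (F ∩ ∁ (incident G z)) x y → Walk (λ f → f ∈ F × f ≢ e) x y
    avoiding z at = fromReach λ f f∈ → let f∈F , f∉star = x∈p∩q⁻ F _ f∈ in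
      f∈F , λ { refl → x∈∁p⇒x∉p f∉star (ends-incident e z at) }

  -- If G − I is connected and the ends of e are joined in G − I − e, then
  -- G − I − e is connected: reroute every use of e along the detour.
  bypass : ∀ I e → Walk (Avoiding I e) (end₁ e) (end₂ e) →
           Connected (_∉ I) → Connected (Avoiding I e)
  bypass I e around connected u v = reroute (connected u v)
    where
    reroute : ∀ {x y} → Walk (_∉ I) x y → Walk (Avoiding I e) x y
    reroute nil = nil
    reroute (cons f f∉I j r) with f ≟ᶠ e
    ... | no f≢e = cons f (f∉I , f≢e) j (reroute r)
    ... | yes refl with j
    ...   | inj₁ (refl , refl) = around ++ reroute r
    ...   | inj₂ (refl , refl) = reverse around ++ reroute r

  side : Subset n → Fin n → Bool
  side W v = ⌊ v ∈? W ⌋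

  side-in : ∀ W {v} → v ∈ W → side W v ≡ true
  side-in W {v} v∈W = trans (isYes≗does (v ∈? W)) (dec-true (v ∈? W) v∈W)

  side-out : ∀ W {v} → v ∉ W → side W v ≡ false
  side-out W {v} v∉W = trans (isYes≗does (v ∈? W)) (dec-false (v ∈? W) v∉W)

  uncut-edge : ∀ W f → f ∉ ∂ G W → side W (end₁ f) ≡ side W (end₂ f)
  uncut-edge W f f∉∂ with lookup (∂ G W) f in crossing
  ... | true  = ⊥-elim (f∉∂ (lookup⇒[]= f (∂ G W) crossing))
  ... | false = xor-false (trans (sym (lookup∘tabulate _ f)) crossing)
    where
    xor-false : ∀ {a b} → a xor b ≡ false → a ≡ b
    xor-false {true}  {true}  _ = refl
    xor-false {false} {false} _ = refl

  same-side : ∀ W {u v} → Walk (_∉ ∂ G W) u v → side W u ≡ side W v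
  same-side W nil                = refl
  same-side W (cons f f∉∂ j r) = trans (along j) (same-side W r)
    where
    along : ∀ {x y} → Joins G f x y → side W x ≡ side W y
    along (inj₁ (refl , refl)) = uncut-edge W f f∉∂
    along (inj₂ (refl , refl)) = sym (uncut-edge W f f∉∂)

  covers-far-side : ∀ W Î → ConnectedSub G (InV G (∁ Î)) (∁ Î) → (∀ f → f ∈ ∁ Î → f ∉ ∂ G W) →
    ∀ {a} → InV G (∁ Î) a → ∀ {z} → side W z ≢ side W a → incident G z ⊆ Î
  covers-far-side W Î connected uncut {a} Fa {z} opposite {e} e∈star with e ∈? Î
  ... | yes e∈Î = e∈Î
  ... | no  e∉Î = ⊥-elim (opposite (sym (same-side W (fromReach uncut (connected a z Fa Fz)))))
    where
    Fz : InV G (∁ Î) z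
    Fz = e , x∉p⇒x∈∁p e∉Î , incident-ends e z e∈star

  -- Then Î contains the
  -- stars of all vertices on one side of the cut: by maximality and the
  -- detours of the 2-connected part, no edge outside Î crosses the cut.
  one-side-covered : ∀ W I Î → MaximalAmong (allFin m) (∂ G W) I → I ⊆ Î →
    ((∀ e → e ∈ Î) ⊎ TwoConnectedEdgeSet G (∁ Î)) → Covers Î W ⊎ Covers Î (∁ W)
  one-side-covered W I Î _ _ (inj₁ everything) = inj₁ (λ _ _ → everything _)
  one-side-covered W I Î (_ , connected , maximal) I⊆Î
                   (inj₂ twoConn@((a , _ , _ , Fa , _) , connectedF , _)) = choose (a ∈? W)
    where
    ∉I : ∀ {f} → f ∈ ∁ Î → f ∉ I
    ∉I f∈F = x∈∁p⇒x∉p f∈F ∘ I⊆Î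
    uncut : ∀ f → f ∈ ∁ Î → f ∉ ∂ G W
    uncut f f∈F f∈∂ = maximal f (∈-allFin f) f∈∂ (∉I f∈F)
      (bypass I f (weaken (λ g (g∈F , g≢f) → ∉I g∈F , g≢f) (detour (∁ Î) twoConn f f∈F)) connected)
    far : ∀ {z} → side W z ≢ side W a → incident G z ⊆ Î
    far = covers-far-side W Î connectedF uncut Fa
    different : ∀ {x y} → x ≡ true → y ≡ false → x ≢ y
    different refl refl ()
    choose : Dec (a ∈ W) → Covers Î W ⊎ Covers Î (∁ W)
    choose (yes a∈W) =
      inj₂ λ z∈∁W → far (different (side-in W a∈W) (side-out W (x∈∁p⇒x∉p z∈∁W)) ∘ sym)
    choose (no  a∉W) = inj₁ λ z∈W → far (different (side-in W z∈W) (side-out W a∉W))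

module BalancedCuts {ℰ : Graph → Set} {p q : ℕ} (setting : Setting ℰ p q) (G : Graph) (G∈ℰ : ℰ G) where
  open Graph G
  open Setting setting
  open DoubleCounting G using (Covers; covered-small)
  open Walks G using (Connected; MaximalAmong; fromReach; greedy; connected⇒independent)
  open Cuts G using (one-side-covered)

  balanced-cut : ∀ X → RankAtMost G X (ell G p q) →
                 ∀ W → n < 3 * ∣ W ∣ → 3 * ∣ W ∣ ≤ 2 * n → ∂ G W ⊆ X → ⊥
  balanced-cut X rank W large small ∂W⊆X = greedy connected (∂ G W) (allFin m) no-maximal
    where
    cubic : Cubic G
    cubic = proj₁ (simpleCubic2conn G G∈ℰ)
    connected : Connected (λ _ → 𝟏)
    connected u v with simpleCubic2conn G G∈ℰ
    ... | _ , _ , connected-G , _ = fromReach (λ _ _ → tt) (connected-G u v tt tt)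
    ∣∁W∣+∣W∣≡n : ∣ ∁ W ∣ + ∣ W ∣ ≡ n
    ∣∁W∣+∣W∣≡n = trans (cong (_+ ∣ W ∣) (∣∁p∣≡n∸∣p∣ W)) (m∸n+n≡m (∣p∣≤n W))
    0<n : 0 < n
    0<n = positive {w = ∣ W ∣} large small
    ∁W-large : n ≤ 3 * ∣ ∁ W ∣
    ∁W-large = complement-bound {s = ∣ ∁ W ∣} {w = ∣ W ∣} ∣∁W∣+∣W∣≡n small
    neither-side : ∀ {T} → 3 * ∣ T ∣ ≤ m ∸ 1 → Covers T W ⊎ Covers T (∁ W) → ⊥
    neither-side T-small (inj₁ covers-W)  =
      <-asym large (covered-small cubic 0<n T-small covers-W)
    neither-side T-small (inj₂ covers-∁W) =
      <-irrefl refl (<-≤-trans (covered-small cubic 0<n T-small covers-∁W) ∁W-large)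
    no-maximal : ¬ Σ (Subset m) (MaximalAmong (allFin m) (∂ G W))
    no-maximal (I , maximal@(I⊆∂W , G−I-connected , _)) with closeUp G G∈ℰ I
    ... | Î , I⊆Î , Î-size , shape =
      neither-side (closure-bound m p q I-small Î-size) (one-side-covered W I Î maximal I⊆Î shape)
      where
      I-small : ∣ I ∣ ≤ ell G p q
      I-small = rank I (∂W⊆X ∘ I⊆∂W) (connected⇒independent I G−I-connected)

mainTheorem10 : (ℰ : Graph → Set) (p q : ℕ) → Setting ℰ p q →
    (G : Graph) → ℰ G →
    (o : Orientation G) (Γ : AbelianGroup 0ℓ 0ℓ) → FiniteAbelianGroup Γ →
    (σ : Fin (Graph.n G) → AbelianGroup.Carrier Γ) →
    (X : Subset (Graph.m G)) (ψ : Fin (Graph.m G) → AbelianGroup.Carrier Γ) →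
    RankAtMost G X (ell G p q) →
    Consistent G Γ o σ X ψ (Graph.n G / 3) →
    Consistent G Γ o σ X ψ ((2 * Graph.n G) / 3)
mainTheorem10 ℰ p q setting G G∈ℰ o Γ _ σ X ψ rank consistent W W≤2n/3 ∂W⊆X
  with ∣ W ∣ ≤? Graph.n G / 3
... | yes W≤n/3 = consistent W W≤n/3 ∂W⊆X
... | no  W>n/3 = ⊥-elim (BalancedCuts.balanced-cut setting G G∈ℰ X rank W
                            (div3-below (Graph.n G) ∣ W ∣ (≰⇒> W>n/3))
                            (div3-above (Graph.n G) ∣ W ∣ W≤2n/3) ∂W⊆X)
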